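{- Let $\ell$ be a prime, $M$ a positive integer, $r=\nu_\ell(M)$, and $s\ge0$ an integer. Then \[ \#\{\sigma\in\mathrm{Mat}_2(\mathbb Z/\ell^{r+s}\mathbb Z):\det(\sigma)\equiv M\pmod{\ell^{r+s}}\}=\ell^{2(r-1)}\left(\ell^{3s}(\ell+1)(\ell^{r+1}-1)+\delta(s)\right), \] where $\delta(s)=1$ if $s=0$ and $\delta(s)=0$ otherwise.
   Context: $\mathrm{Mat}_2(R)$ is the ring of $2\times2$ matrices over $R$; $\nu_\ell$ is the $\ell$-adic valuation. -}

module Defs where

open import Data.Nat using (ℕ; zero; suc)
open import Data.Fin using (Fin; toℕ)
open import Data.Integer as ℤ using (ℤ; +_; _-_; _*_)
open import Data.Integer.Divisibility.Signed using (_∣_; _∣?_)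
open import Data.List using (List; length; filter; cartesianProduct; allFin)
open import Data.Product using (_×_; _,_)

-- 2×2 matrices over ℤ/Nℤ, entries represented by their canonical
-- representatives in Fin N = {0,…,N-1}; a matrix (a , b , c , d) is [[a, b], [c, d]].
Mat₂ : ℕ → Set
Mat₂ N = Fin N × Fin N × Fin N × Fin N

allMat₂ : (N : ℕ) → List (Mat₂ N)
allMat₂ N = cartesianProduct (allFin N)
              (cartesianProduct (allFin N) (cartesianProduct (allFin N) (allFin N)))

-- integer determinant of the lift of σ (well-defined mod N)
detℤ : {N : ℕ} → Mat₂ N → ℤ
detℤ (a , b , c , d) = (+ toℕ a) * (+ toℕ d) - (+ toℕ b) * (+ toℕ c)

DetCong : (N M : ℕ) → Mat₂ N → Set
DetCong N M σ = (+ N) ∣ (detℤ σ - + M)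

countDet : (N M : ℕ) → ℕ
countDet N M = length (filter (λ σ → (+ N) ∣? (detℤ σ - + M)) (allMat₂ N))

δ : ℕ → ℕ
δ zero    = 1
δ (suc _) = 0

-- Count matrices mod N = ℓ^(k+1) by their first row (a, b).  If ℓ ∤ a (or ℓ ∤ b), then
-- ad − bc ≡ M is a linear congruence in d (or c) with unit coefficient, so the row has exactly N
-- completions (c, d).  If ℓ divides a and b, then ℓ must divide M, and for M = M′ℓ, a = jℓ, b = j′ℓ
-- the congruence mod ℓ^(k+1) becomes one mod ℓ^k in which c, d only matter mod ℓ^k.  Hence
-- #(ℓ^(k+1), M) = (ℓ² − 1) ℓ^(3k+1) when ℓ ∤ M, and #(ℓ^(k+1), M′ℓ) = ℓ² #(ℓ^k, M′) + (ℓ² − 1) ℓ^(3k+1);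
-- induction on r = ν_ℓ(M) then yields the closed form.

module Submission where

open import Defs
open import Data.Nat as ℕ using (ℕ; zero; suc; NonZero)
open import Data.Integer as ℤ using (ℤ)
open import Data.Fin as Fin using (Fin; toℕ)
open import Data.Product using (∃; _×_; _,_)
open import Data.Sum using (inj₁; inj₂)
open import Data.Empty using (⊥-elim)
open import Function using (_∘_; id)
open import Relation.Binary.PropositionalEquality
open import Relation.Nullary using (Dec; yes; no; ¬_)

module FiniteSums where

  open import Data.Nat using (_+_; _*_; _<_; z≤n; s≤s)
  open import Data.Nat.Properties
    using (+-assoc; *-zeroʳ; *-identityʳ; *-distribˡ-+; 0≢1+n; suc-injective; +-commutativeSemigroup)
  open import Algebra.Properties.CommutativeSemigroup +-commutativeSemigroup
    using () renaming (interchange to +-interchange)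
  open ≡-Reasoning

  ∑ : ℕ → (ℕ → ℕ) → ℕ
  ∑ zero    f = 0
  ∑ (suc n) f = f 0 + ∑ n (f ∘ suc)

  syntax ∑ n (λ i → f) = ∑[ i < n ] f

  ∑-cong-< : ∀ n {f g : ℕ → ℕ} → (∀ {i} → i < n → f i ≡ g i) → ∑ n f ≡ ∑ n g
  ∑-cong-< zero    eq = refl
  ∑-cong-< (suc n) eq = cong₂ _+_ (eq (s≤s z≤n)) (∑-cong-< n (eq ∘ s≤s))

  ∑-cong : ∀ n {f g : ℕ → ℕ} → (∀ i → f i ≡ g i) → ∑ n f ≡ ∑ n g
  ∑-cong n eq = ∑-cong-< n (λ {i} _ → eq i)

  ∑-const : ∀ n k → ∑[ _ < n ] k ≡ n * k
  ∑-const zero    k = refl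
  ∑-const (suc n) k = cong (k +_) (∑-const n k)

  ∑-zero : ∀ n → ∑[ _ < n ] 0 ≡ 0
  ∑-zero n = trans (∑-const n 0) (*-zeroʳ n)

  ∑-const-1 : ∀ n → ∑[ _ < n ] 1 ≡ n
  ∑-const-1 n = trans (∑-const n 1) (*-identityʳ n)

  ∑-+ : ∀ m n f → ∑ (m + n) f ≡ ∑ m f + ∑[ i < n ] f (m + i)
  ∑-+ zero    n f = refl
  ∑-+ (suc m) n f = trans (cong (f 0 +_) (∑-+ m n (f ∘ suc))) (sym (+-assoc (f 0) _ _))

  ∑-blocks : ∀ m k f → ∑ (m * k) f ≡ ∑[ j < m ] ∑[ t < k ] f (j * k + t)
  ∑-blocks zero    k f = refl
  ∑-blocks (suc m) k f = begin
    ∑ (k + m * k) f                                        ≡⟨ ∑-+ k (m * k) f ⟩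
    ∑ k f + ∑ (m * k) (λ i → f (k + i))                    ≡⟨ cong (∑ k f +_) (∑-blocks m k (λ i → f (k + i))) ⟩
    ∑ k f + ∑[ j < m ] ∑[ t < k ] f (k + (j * k + t))      ≡⟨ cong (∑ k f +_) (∑-cong m λ j → ∑-cong k λ t →
                                                                cong f (sym (+-assoc k (j * k) t))) ⟩
    ∑ k f + ∑[ j < m ] ∑[ t < k ] f (suc j * k + t)        ∎

  ∑-distrib-+ : ∀ n f g → ∑[ i < n ] (f i + g i) ≡ ∑ n f + ∑ n g
  ∑-distrib-+ zero    f g = refl
  ∑-distrib-+ (suc n) f g = trans (cong (f 0 + g 0 +_) (∑-distrib-+ n (f ∘ suc) (g ∘ suc)))
                                  (+-interchange (f 0) (g 0) (∑ n (f ∘ suc)) (∑ n (g ∘ suc)))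

  ∑-distribˡ-* : ∀ n k f → ∑[ i < n ] (k * f i) ≡ k * ∑ n f
  ∑-distribˡ-* zero    k f = sym (*-zeroʳ k)
  ∑-distribˡ-* (suc n) k f =
    trans (cong (k * f 0 +_) (∑-distribˡ-* n k (f ∘ suc))) (sym (*-distribˡ-+ k (f 0) _))

  ∑-comm : ∀ m n (f : ℕ → ℕ → ℕ) → ∑[ i < m ] ∑[ j < n ] f i j ≡ ∑[ j < n ] ∑[ i < m ] f i j
  ∑-comm zero    n f = sym (∑-zero n)
  ∑-comm (suc m) n f = trans (cong (∑ n (f 0) +_) (∑-comm m n (f ∘ suc)))
                             (sym (∑-distrib-+ n (f 0) (λ j → ∑[ i < m ] f (suc i) j)))

  ∑-periodic : ∀ q p f → (∀ j t → f (j * p + t) ≡ f t) → ∑ (q * p) f ≡ q * ∑ p f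
  ∑-periodic q p f periodic = begin
    ∑ (q * p) f                            ≡⟨ ∑-blocks q p f ⟩
    ∑[ j < q ] ∑[ t < p ] f (j * p + t)    ≡⟨ ∑-cong q (λ j → ∑-cong p (periodic j)) ⟩
    ∑[ j < q ] ∑ p f                       ≡⟨ ∑-const q (∑ p f) ⟩
    q * ∑ p f                              ∎

  𝟙 : {P : Set} → Dec P → ℕ
  𝟙 (yes _) = 1
  𝟙 (no  _) = 0

  𝟙-cong : {P Q : Set} (p : Dec P) (q : Dec Q) → (P → Q) → (Q → P) → 𝟙 p ≡ 𝟙 q
  𝟙-cong (yes _) (yes _) _   _   = refl
  𝟙-cong (yes p) (no ¬q) p⇒q _   = ⊥-elim (¬q (p⇒q p))
  𝟙-cong (no ¬p) (yes q) _   q⇒p = ⊥-elim (¬p (q⇒p q))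
  𝟙-cong (no _)  (no _)  _   _   = refl

  𝟙-yes : {P : Set} (p : Dec P) → P → 𝟙 p ≡ 1
  𝟙-yes (yes _) _ = refl
  𝟙-yes (no ¬p) p = ⊥-elim (¬p p)

  𝟙-no : {P : Set} (p : Dec P) → ¬ P → 𝟙 p ≡ 0
  𝟙-no (yes p) ¬p = ⊥-elim (¬p p)
  𝟙-no (no _)  _  = refl

  ∑-𝟙-unique : ∀ n {P : ℕ → Set} (P? : ∀ i → Dec (P i)) {w} → w < n → P w →
               (∀ {i} → i < n → P i → i ≡ w) → ∑[ i < n ] 𝟙 (P? i) ≡ 1
  ∑-𝟙-unique (suc n) P? {zero} _ Pw unique = cong₂ _+_ (𝟙-yes (P? 0) Pw) (begin
    ∑[ i < n ] 𝟙 (P? (suc i))   ≡⟨ ∑-cong-< n (λ i<n → 𝟙-no (P? _) (λ Pi → 0≢1+n (sym (unique (s≤s i<n) Pi)))) ⟩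
    ∑[ i < n ] 0                ≡⟨ ∑-zero n ⟩
    0                           ∎)
  ∑-𝟙-unique (suc n) P? {suc w} (s≤s w<n) Pw unique =
    cong₂ _+_ (𝟙-no (P? 0) (λ P0 → 0≢1+n (unique (s≤s z≤n) P0)))
              (∑-𝟙-unique n (P? ∘ suc) w<n Pw (λ i<n Pi → suc-injective (unique (s≤s i<n) Pi)))

open FiniteSums

module ListSums where

  open import Data.Nat using (_+_)
  open import Data.List using (List; []; _∷_; _++_; map; filter; length; tabulate; cartesianProduct; allFin)
  open import Data.List.Properties using (map-++; map-∘; map-tabulate)
  open import Data.Nat.ListAction using (sum)
  open import Data.Nat.ListAction.Properties using (sum-++)
  open import Relation.Unary using (Pred; Decidable)
  open ≡-Reasoning

  length-filter≡sum-𝟙 : ∀ {A : Set} {P : Pred A _} (P? : Decidable P) xs →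
                        length (filter P? xs) ≡ sum (map (𝟙 ∘ P?) xs)
  length-filter≡sum-𝟙 P? []       = refl
  length-filter≡sum-𝟙 P? (x ∷ xs) with P? x
  ... | yes _ = cong suc (length-filter≡sum-𝟙 P? xs)
  ... | no  _ = length-filter≡sum-𝟙 P? xs

  sum-cartesianProduct : ∀ {A B : Set} (f : A × B → ℕ) xs (ys : List B) →
    sum (map f (cartesianProduct xs ys)) ≡ sum (map (λ x → sum (map (λ y → f (x , y)) ys)) xs)
  sum-cartesianProduct f []       ys = refl
  sum-cartesianProduct f (x ∷ xs) ys = begin
    sum (map f (map (x ,_) ys ++ cartesianProduct xs ys))
      ≡⟨ cong sum (map-++ f (map (x ,_) ys) _) ⟩
    sum (map f (map (x ,_) ys) ++ map f (cartesianProduct xs ys))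
      ≡⟨ sum-++ (map f (map (x ,_) ys)) _ ⟩
    sum (map f (map (x ,_) ys)) + sum (map f (cartesianProduct xs ys))
      ≡⟨ cong₂ _+_ (cong sum (sym (map-∘ ys))) (sum-cartesianProduct f xs ys) ⟩
    sum (map (λ y → f (x , y)) ys) + sum (map (λ x → sum (map (λ y → f (x , y)) ys)) xs)
      ∎

  sum-tabulate : ∀ n (f : Fin n → ℕ) (g : ℕ → ℕ) → (∀ i → f i ≡ g (toℕ i)) → sum (tabulate f) ≡ ∑ n g
  sum-tabulate zero    f g eq = refl
  sum-tabulate (suc n) f g eq = cong₂ _+_ (eq Fin.zero) (sum-tabulate n (f ∘ Fin.suc) (g ∘ suc) (eq ∘ Fin.suc))

  sum-allFin : ∀ n (f : Fin n → ℕ) (g : ℕ → ℕ) → (∀ i → f i ≡ g (toℕ i)) → sum (map f (allFin n)) ≡ ∑ n g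
  sum-allFin n f g eq = trans (cong sum (map-tabulate id f)) (sum-tabulate n f g eq)

open ListSums

module Congruences where

  open import Data.Nat using (_<_; _^_) renaming (_*_ to _*ₙ_)
  import Data.Nat.Properties as ℕₚ
  open import Data.Nat.Divisibility as ℕᵈ using () renaming (_∣_ to _∣ₙ_)
  open import Data.Nat.Coprimality using (Coprime; coprime-Bézout; coprime-divisor; 1-coprimeTo)
    renaming (sym to coprime-sym)
  open import Data.Nat.GCD using (module Bézout)
  open import Data.Nat.Primality using (Prime; prime⇒irreducible)
  open import Data.Integer using (+_; -_; 0ℤ; 1ℤ; _+_; _-_; _*_; ∣_∣)
  open import Data.Integer.Properties
    using (pos-+; pos-*; abs-*; ∣i∣≡0⇒i≡0; i-j≡0⇒i≡j; +-injective; [+m]-[+n]≡m⊖n; ∣m⊝n∣≤m⊔n)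
  open import Data.Integer.Divisibility.Signed
  open import Data.Integer.DivMod using (_%ℕ_; _/ℕ_; n%ℕd<d; a≡a%ℕn+[a/ℕn]*n)
  open import Data.Integer.Tactic.RingSolver using (solve-∀)
  open ≡-Reasoning

  multiple<⇒≡0 : ∀ {N e} → ∣ e ∣ < N → + N ∣ e → e ≡ 0ℤ
  multiple<⇒≡0 {N} {e} e<N N∣e with ∣ e ∣ in ∣e∣≡
  ... | zero  = ∣i∣≡0⇒i≡0 ∣e∣≡
  ... | suc _ = ⊥-elim (ℕₚ.<⇒≱ e<N (ℕᵈ.∣⇒≤ (subst (N ∣ₙ_) ∣e∣≡ (∣⇒∣ᵤ N∣e))))

  residue-unique : ∀ {N i j} → i < N → j < N → + N ∣ + i - + j → i ≡ j
  residue-unique {N} {i} {j} i<N j<N N∣i-j =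
    +-injective (i-j≡0⇒i≡j (+ i) (+ j) (multiple<⇒≡0 ∣i-j∣<N N∣i-j))
    where
    ∣i-j∣<N : ∣ + i - + j ∣ < N
    ∣i-j∣<N = subst (λ k → ℕ.suc k ℕ.≤ N) (cong ∣_∣ (sym ([+m]-[+n]≡m⊖n i j)))
                (ℕₚ.≤-trans (ℕ.s≤s (∣m⊝n∣≤m⊔n i j)) (ℕₚ.⊔-lub i<N j<N))

  coprime-∣-cancelˡ : ∀ {N a} e → Coprime a N → + N ∣ + a * e → + N ∣ e
  coprime-∣-cancelˡ {N} {a} e a⊥N N∣ae =
    ∣ᵤ⇒∣ (coprime-divisor (coprime-sym a⊥N) (subst (N ∣ₙ_) (abs-* (+ a) e) (∣⇒∣ᵤ N∣ae)))

  +-homo-Bézout : ∀ p q r s → 1 ℕ.+ p *ₙ q ≡ r *ₙ s → 1ℤ + + p * + q ≡ + r * + s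
  +-homo-Bézout p q r s eq = begin
    1ℤ + + p * + q      ≡⟨ cong (_+_ 1ℤ) (pos-* p q) ⟨
    1ℤ + + (p *ₙ q)     ≡⟨ pos-+ 1 (p *ₙ q) ⟨
    + (1 ℕ.+ p *ₙ q)    ≡⟨ cong +_ eq ⟩
    + (r *ₙ s)          ≡⟨ pos-* r s ⟩
    + r * + s           ∎

  coprime-inverse : ∀ {N a} → Coprime a N → ∃ λ u → + N ∣ + a * u - 1ℤ
  coprime-inverse {N} {a} a⊥N with coprime-Bézout a⊥N
  ... | Bézout.+- x y eq = + x , divides (+ y) (begin
    + a * + x - 1ℤ          ≡⟨ swap (+ a) (+ x) ⟩
    + x * + a - 1ℤ          ≡⟨ cong (_- 1ℤ) (+-homo-Bézout y N x a eq) ⟨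
    1ℤ + + y * + N - 1ℤ     ≡⟨ cancel (+ y * + N) ⟩
    + y * + N               ∎)
    where
    swap : ∀ a x → a * x - 1ℤ ≡ x * a - 1ℤ
    swap = solve-∀
    cancel : ∀ z → 1ℤ + z - 1ℤ ≡ z
    cancel = solve-∀
  ... | Bézout.-+ x y eq = - + x , divides (- + y) (begin
    + a * - + x - 1ℤ        ≡⟨ negate (+ a) (+ x) ⟩
    - (1ℤ + + x * + a)      ≡⟨ cong -_ (+-homo-Bézout x a y N eq) ⟩
    - (+ y * + N)           ≡⟨ neg-* (+ y) (+ N) ⟩
    - + y * + N             ∎)
    where
    negate : ∀ a x → a * - x - 1ℤ ≡ - (1ℤ + x * a)
    negate = solve-∀
    neg-* : ∀ y n → - (y * n) ≡ - y * n
    neg-* = solve-∀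

  coprime-*ʳ : ∀ {a m n} → Coprime a m → Coprime a n → Coprime a (m *ₙ n)
  coprime-*ʳ a⊥m a⊥n (d∣a , d∣mn) =
    a⊥n (d∣a , coprime-divisor (λ (e∣d , e∣m) → a⊥m (ℕᵈ.∣-trans e∣d d∣a , e∣m)) d∣mn)

  prime∤⇒coprime : ∀ {ℓ a} → Prime ℓ → ¬ ℓ ∣ₙ a → Coprime a ℓ
  prime∤⇒coprime ℓ-prime ℓ∤a (d∣a , d∣ℓ) with prime⇒irreducible ℓ-prime d∣ℓ
  ... | inj₁ d≡1    = d≡1
  ... | inj₂ refl   = ⊥-elim (ℓ∤a d∣a)

  prime∤⇒coprime-^ : ∀ {ℓ a} → Prime ℓ → ¬ ℓ ∣ₙ a → ∀ n → Coprime a (ℓ ^ n)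
  prime∤⇒coprime-^ {a = a} ℓ-prime ℓ∤a zero    = coprime-sym (1-coprimeTo a)
  prime∤⇒coprime-^         ℓ-prime ℓ∤a (suc n) =
    coprime-*ʳ (prime∤⇒coprime ℓ-prime ℓ∤a) (prime∤⇒coprime-^ ℓ-prime ℓ∤a n)

  χ : ℕ → ℤ → ℕ
  χ N e = 𝟙 (+ N ∣? e)

  ∑-χ-affine : ∀ {N a} .{{_ : NonZero N}} → Coprime a N → ∀ y → ∑[ d < N ] χ N (+ a * + d + y) ≡ 1
  ∑-χ-affine {N} {a} a⊥N y with coprime-inverse a⊥N
  ... | u , N∣au-1 = ∑-𝟙-unique N (λ d → + N ∣? (+ a * + d + y)) (n%ℕd<d z N) N∣root unique
    where
    z = - (u * y)
    w = z %ℕ N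
    root-expand : ∀ a u y t n → a * (- (u * y) - t * n) + y ≡ - y * (a * u - 1ℤ) + - (a * t) * n
    root-expand = solve-∀
    diff : ∀ a i w y → (a * i + y) - (a * w + y) ≡ a * (i - w)
    diff = solve-∀
    +w≡ : + w ≡ z - (z /ℕ N) * + N
    +w≡ = trans (sym (cancel (+ w) ((z /ℕ N) * + N))) (cong (_- (z /ℕ N) * + N) (sym (a≡a%ℕn+[a/ℕn]*n z N)))
      where
      cancel : ∀ w x → w + x - x ≡ w
      cancel = solve-∀
    N∣root : + N ∣ + a * + w + y
    N∣root = subst (+ N ∣_)
      (sym (trans (cong (λ v → + a * v + y) +w≡) (root-expand (+ a) u y (z /ℕ N) (+ N))))
      (∣m∣n⇒∣m+n (∣n⇒∣m*n (- y) N∣au-1) (divides (- (+ a * (z /ℕ N))) refl))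
    unique : ∀ {i} → i < N → + N ∣ + a * + i + y → i ≡ w
    unique {i} i<N N∣ai+y = residue-unique i<N (n%ℕd<d z N)
      (coprime-∣-cancelˡ (+ i - + w) a⊥N (subst (+ N ∣_) (diff (+ a) (+ i) (+ w) y) (∣m∣n⇒∣m-n N∣ai+y N∣root)))

open Congruences

module Completions where

  open import Data.Nat.Divisibility as ℕᵈ using () renaming (_∣_ to _∣ₙ_)
  open import Data.Nat.Coprimality using (Coprime)
  open import Data.List using (allFin)
  open import Data.Integer using (+_; -_; _+_; _-_; _*_)
  open import Data.Integer.Properties using (pos-+; pos-*; neg-involutive)
  open import Data.Integer.Divisibility.Signed
  open import Data.Integer.Tactic.RingSolver using (solve-∀)
  open ≡-Reasoning

  detDiff : ℕ → ℕ → ℕ → ℕ → ℕ → ℤ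
  detDiff M a b c d = + a * + d - + b * + c - + M

  completions : ℕ → ℕ → ℕ → ℕ → ℕ
  completions N M a b = ∑[ c < N ] ∑[ d < N ] χ N (detDiff M a b c d)

  count : ℕ → ℕ → ℕ
  count N M = ∑[ a < N ] ∑[ b < N ] completions N M a b

  countDet≡count : ∀ N M → countDet N M ≡ count N M
  countDet≡count N M =
    trans (length-filter≡sum-𝟙 _ (allMat₂ N)) (
    trans (sum-cartesianProduct _ (allFin N) _) (sum-allFin N _ _ λ _ →
    trans (sum-cartesianProduct _ (allFin N) _) (sum-allFin N _ _ λ _ →
    trans (sum-cartesianProduct _ (allFin N) _) (sum-allFin N _ _ λ _ →
    sum-allFin N _ _ λ _ → refl))))

  count-one : ∀ M → count 1 M ≡ 1
  count-one M = cong (λ x → x ℕ.+ 0 ℕ.+ 0 ℕ.+ 0 ℕ.+ 0) (𝟙-yes _ (∣ᵤ⇒∣ (ℕᵈ.1∣ _)))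

  χ-neg : ∀ N e → χ N (- e) ≡ χ N e
  χ-neg N e = 𝟙-cong _ _ (subst (+ N ∣_) (neg-involutive e) ∘ ∣m⇒∣-m) ∣m⇒∣-m

  χ-periodic : ∀ N e z → χ N (e + + N * z) ≡ χ N e
  χ-periodic N e z = 𝟙-cong _ _ (λ N∣ → ∣m+n∣n⇒∣m N∣ N∣Nz) (λ N∣ → ∣m∣n⇒∣m+n N∣ N∣Nz)
    where
    N∣Nz : + N ∣ + N * z
    N∣Nz = ∣m⇒∣m*n z ∣-refl

  χ-scale : ∀ ℓ .{{_ : NonZero ℓ}} N e → χ (ℓ ℕ.* N) (+ ℓ * e) ≡ χ N e
  χ-scale ℓ N e = 𝟙-cong _ _
    (λ ℓN∣ℓe → *-cancelˡ-∣ (+ ℓ) (subst (_∣ + ℓ * e) (pos-* ℓ N) ℓN∣ℓe))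
    (λ N∣e → subst (_∣ + ℓ * e) (sym (pos-* ℓ N)) (*-monoʳ-∣ (+ ℓ) N∣e))

  completions-coprimeˡ : ∀ {N} .{{_ : NonZero N}} M {a} b → Coprime a N → completions N M a b ≡ N
  completions-coprimeˡ {N} M {a} b a⊥N = begin
    ∑[ c < N ] ∑[ d < N ] χ N (detDiff M a b c d)
      ≡⟨ ∑-cong N (λ c → ∑-cong N λ d → cong (χ N) (regroup (+ a) (+ b) (+ c) (+ d) (+ M))) ⟩
    ∑[ c < N ] ∑[ d < N ] χ N (+ a * + d + (- (+ b * + c) - + M))
      ≡⟨ ∑-cong N (λ c → ∑-χ-affine a⊥N _) ⟩
    ∑[ c < N ] 1
      ≡⟨ ∑-const-1 N ⟩
    N ∎
    where
    regroup : ∀ a b c d M → a * d - b * c - M ≡ a * d + (- (b * c) - M)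
    regroup = solve-∀

  completions-coprimeʳ : ∀ {N} .{{_ : NonZero N}} M a {b} → Coprime b N → completions N M a b ≡ N
  completions-coprimeʳ {N} M a {b} b⊥N = begin
    ∑[ c < N ] ∑[ d < N ] χ N (detDiff M a b c d)
      ≡⟨ ∑-comm N N _ ⟩
    ∑[ d < N ] ∑[ c < N ] χ N (detDiff M a b c d)
      ≡⟨ ∑-cong N (λ d → ∑-cong N λ c → trans (sym (χ-neg N _))
           (cong (χ N) (regroup (+ a) (+ b) (+ c) (+ d) (+ M)))) ⟩
    ∑[ d < N ] ∑[ c < N ] χ N (+ b * + c + (+ M - + a * + d))
      ≡⟨ ∑-cong N (λ d → ∑-χ-affine b⊥N _) ⟩
    ∑[ d < N ] 1
      ≡⟨ ∑-const-1 N ⟩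
    N ∎
    where
    regroup : ∀ a b c d M → - (a * d - b * c - M) ≡ b * c + (M - a * d)
    regroup = solve-∀

  detDiff-multiples : ∀ ℓ M a b c d →
    detDiff M (a ℕ.* ℓ) (b ℕ.* ℓ) c d ≡ (+ a * + d - + b * + c) * + ℓ - + M
  detDiff-multiples ℓ M a b c d = begin
    + (a ℕ.* ℓ) * + d - + (b ℕ.* ℓ) * + c - + M
      ≡⟨ cong₂ (λ x y → x * + d - y * + c - + M) (pos-* a ℓ) (pos-* b ℓ) ⟩
    + a * + ℓ * + d - + b * + ℓ * + c - + M
      ≡⟨ regroup (+ a) (+ b) (+ c) (+ d) (+ ℓ) (+ M) ⟩
    (+ a * + d - + b * + c) * + ℓ - + M ∎
    where
    regroup : ∀ a b c d ℓ M → a * ℓ * d - b * ℓ * c - M ≡ (a * d - b * c) * ℓ - M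
    regroup = solve-∀

  completions-vanish : ∀ {ℓ N M} a b → ℓ ∣ₙ N → ¬ ℓ ∣ₙ M → completions N M (a ℕ.* ℓ) (b ℕ.* ℓ) ≡ 0
  completions-vanish {ℓ} {N} {M} a b ℓ∣N ℓ∤M =
    trans (∑-cong N (λ c → trans (∑-cong N λ d → 𝟙-no _ (ℓ∤M ∘ ∣⇒∣ᵤ ∘ ℓ∣M c d)) (∑-zero N)))
          (∑-zero N)
    where
    regroup : ∀ x ℓ M → M ≡ x * ℓ - (x * ℓ - M)
    regroup = solve-∀
    ℓ∣M : ∀ c d → + N ∣ detDiff M (a ℕ.* ℓ) (b ℕ.* ℓ) c d → + ℓ ∣ + M
    ℓ∣M c d N∣ = subst (+ ℓ ∣_) (sym (regroup (+ a * + d - + b * + c) (+ ℓ) (+ M)))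
      (∣m∣n⇒∣m-n (∣n⇒∣m*n (+ a * + d - + b * + c) ∣-refl)
                 (subst (+ ℓ ∣_) (detDiff-multiples ℓ M a b c d) (∣-trans (∣ᵤ⇒∣ ℓ∣N) N∣)))

  +-homo-affine : ∀ j N t → + (j ℕ.* N ℕ.+ t) ≡ + j * + N + + t
  +-homo-affine j N t = trans (pos-+ (j ℕ.* N) t) (cong (_+ + t) (pos-* j N))

  completions-scale : ∀ ℓ .{{_ : NonZero ℓ}} N M a b →
    completions (ℓ ℕ.* N) (M ℕ.* ℓ) (a ℕ.* ℓ) (b ℕ.* ℓ) ≡ ℓ ℕ.* (ℓ ℕ.* completions N M a b)
  completions-scale ℓ N M a b = begin
    ∑[ c < ℓ ℕ.* N ] ∑[ d < ℓ ℕ.* N ] χ (ℓ ℕ.* N) (detDiff (M ℕ.* ℓ) (a ℕ.* ℓ) (b ℕ.* ℓ) c d)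
      ≡⟨ ∑-cong (ℓ ℕ.* N) (λ c → ∑-cong (ℓ ℕ.* N) λ d →
           trans (cong (χ (ℓ ℕ.* N)) (detDiff-scale c d)) (χ-scale ℓ N _)) ⟩
    ∑[ c < ℓ ℕ.* N ] ∑[ d < ℓ ℕ.* N ] χ N (detDiff M a b c d)
      ≡⟨ ∑-cong (ℓ ℕ.* N) (λ c → ∑-periodic ℓ N _ (periodic-d c)) ⟩
    ∑[ c < ℓ ℕ.* N ] (ℓ ℕ.* ∑[ d < N ] χ N (detDiff M a b c d))
      ≡⟨ ∑-distribˡ-* (ℓ ℕ.* N) ℓ _ ⟩
    ℓ ℕ.* (∑[ c < ℓ ℕ.* N ] ∑[ d < N ] χ N (detDiff M a b c d))
      ≡⟨ cong (ℓ ℕ.*_) (∑-periodic ℓ N _ periodic-c) ⟩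
    ℓ ℕ.* (ℓ ℕ.* completions N M a b) ∎
    where
    factor-ℓ : ∀ x ℓ M → x * ℓ - M * ℓ ≡ ℓ * (x - M)
    factor-ℓ = solve-∀
    detDiff-scale : ∀ c d → detDiff (M ℕ.* ℓ) (a ℕ.* ℓ) (b ℕ.* ℓ) c d ≡ + ℓ * detDiff M a b c d
    detDiff-scale c d = begin
      detDiff (M ℕ.* ℓ) (a ℕ.* ℓ) (b ℕ.* ℓ) c d
        ≡⟨ detDiff-multiples ℓ (M ℕ.* ℓ) a b c d ⟩
      (+ a * + d - + b * + c) * + ℓ - + (M ℕ.* ℓ)
        ≡⟨ cong (λ m → (+ a * + d - + b * + c) * + ℓ - m) (pos-* M ℓ) ⟩
      (+ a * + d - + b * + c) * + ℓ - + M * + ℓ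
        ≡⟨ factor-ℓ (+ a * + d - + b * + c) (+ ℓ) (+ M) ⟩
      + ℓ * detDiff M a b c d ∎
    shift-d : ∀ a b c j N t M → a * (j * N + t) - b * c - M ≡ (a * t - b * c - M) + N * (a * j)
    shift-d = solve-∀
    shift-c : ∀ a b d j N t M → a * d - b * (j * N + t) - M ≡ (a * d - b * t - M) + N * - (b * j)
    shift-c = solve-∀
    periodic-d : ∀ c j t → χ N (detDiff M a b c (j ℕ.* N ℕ.+ t)) ≡ χ N (detDiff M a b c t)
    periodic-d c j t = begin
      χ N (detDiff M a b c (j ℕ.* N ℕ.+ t))
        ≡⟨ cong (λ x → χ N (+ a * x - + b * + c - + M)) (+-homo-affine j N t) ⟩
      χ N (+ a * (+ j * + N + + t) - + b * + c - + M)
        ≡⟨ cong (χ N) (shift-d (+ a) (+ b) (+ c) (+ j) (+ N) (+ t) (+ M)) ⟩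
      χ N (detDiff M a b c t + + N * (+ a * + j))
        ≡⟨ χ-periodic N _ _ ⟩
      χ N (detDiff M a b c t) ∎
    periodic-c : ∀ j t → ∑[ d < N ] χ N (detDiff M a b (j ℕ.* N ℕ.+ t) d) ≡ ∑[ d < N ] χ N (detDiff M a b t d)
    periodic-c j t = ∑-cong N λ d → begin
      χ N (detDiff M a b (j ℕ.* N ℕ.+ t) d)
        ≡⟨ cong (λ x → χ N (+ a * + d - + b * x - + M)) (+-homo-affine j N t) ⟩
      χ N (+ a * + d - + b * (+ j * + N + + t) - + M)
        ≡⟨ cong (χ N) (shift-c (+ a) (+ b) (+ d) (+ j) (+ N) (+ t) (+ M)) ⟩
      χ N (detDiff M a b t d + + N * - (+ b * + j))
        ≡⟨ χ-periodic N _ _ ⟩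
      χ N (detDiff M a b t d) ∎

open Completions

open import Data.Nat using (_+_; _*_; _^_; _∸_; _<_)
open import Data.Nat.Properties
  using (+-identityʳ; *-identityʳ; +-assoc; *-comm; <⇒≱; ≤-pred; ^-*-assoc; ^-distribˡ-+-*; ^-identityʳ; m^n≢0)
open import Data.Nat.Divisibility using (_∣_; divides; ∣⇒≤; ∣m+n∣m⇒∣n; n∣m*n; m∣m*n; m*n∣⇒m∣; *-cancelˡ-∣; *-monoʳ-∣)
open import Data.Nat.Primality using (Prime; ¬prime[0])
open import Data.Nat.Coprimality using (Coprime)
open import Data.Nat.Tactic.RingSolver using (solve-∀)

∑-split-multiples : ∀ ℓ₁ N (f : ℕ → ℕ) c → (∀ a → ¬ suc ℓ₁ ∣ a → f a ≡ c) →
                    ∑[ a < suc ℓ₁ * N ] f a ≡ ∑[ j < N ] f (j * suc ℓ₁) + N * (ℓ₁ * c)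
∑-split-multiples ℓ₁ N f c f-nonmultiple = begin
  ∑ (ℓ * N) f
    ≡⟨ cong (λ m → ∑ m f) (*-comm ℓ N) ⟩
  ∑ (N * ℓ) f
    ≡⟨ ∑-blocks N ℓ f ⟩
  ∑[ j < N ] (f (j * ℓ + 0) + ∑[ t < ℓ₁ ] f (j * ℓ + suc t))
    ≡⟨ ∑-cong N (λ j → cong₂ _+_ (cong f (+-identityʳ (j * ℓ)))
         (trans (∑-cong-< ℓ₁ (λ t<ℓ₁ → f-nonmultiple _ (block-nonmultiple j t<ℓ₁))) (∑-const ℓ₁ c))) ⟩
  ∑[ j < N ] (f (j * ℓ) + ℓ₁ * c)
    ≡⟨ ∑-distrib-+ N _ _ ⟩
  ∑[ j < N ] f (j * ℓ) + ∑[ _ < N ] (ℓ₁ * c)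
    ≡⟨ cong (∑[ j < N ] f (j * ℓ) +_) (∑-const N (ℓ₁ * c)) ⟩
  ∑[ j < N ] f (j * ℓ) + N * (ℓ₁ * c) ∎
  where
  open ≡-Reasoning
  ℓ = suc ℓ₁
  block-nonmultiple : ∀ j {t} → t < ℓ₁ → ¬ ℓ ∣ j * ℓ + suc t
  block-nonmultiple j t<ℓ₁ ℓ∣ = <⇒≱ t<ℓ₁ (≤-pred (∣⇒≤ (∣m+n∣m⇒∣n ℓ∣ (n∣m*n j))))

^-*2 : ∀ m n → m ^ (2 * n) ≡ (m ^ n) ^ 2
^-*2 m n = trans (cong (m ^_) (*-comm 2 n)) (sym (^-*-assoc m n 2))

^-*3 : ∀ m n → m ^ (3 * n) ≡ (m ^ n) ^ 3
^-*3 m n = trans (cong (m ^_) (*-comm 3 n)) (sym (^-*-assoc m n 3))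

^-+1 : ∀ m n → m ^ (n + 1) ≡ m ^ n * m
^-+1 m n = trans (^-distribˡ-+-* m n 1) (cong (m ^ n *_) (^-identityʳ m))

suc*∸1 : ∀ m n .{{_ : NonZero n}} → suc m * n ∸ 1 ≡ (n ∸ 1) + m * n
suc*∸1 m (suc n) = refl

-- The ring solver does not handle _^_, so its goals below spell powers out as products;
-- these agree with the _^_ forms definitionally.
closed-form-step : ∀ ℓ₁ P Q D δ C → let ℓ = suc ℓ₁ in
  ℓ ^ 2 * C ≡ P ^ 2 * (Q ^ 3 * (ℓ + 1) * D + δ) →
  ℓ ^ 2 * (ℓ * (ℓ * C) + ℓ₁ * ℓ * (ℓ + 1) * (P * Q) ^ 3) ≡ (ℓ * P) ^ 2 * (Q ^ 3 * (ℓ + 1) * (D + ℓ₁ * (P * ℓ)) + δ)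
closed-form-step ℓ₁ P Q D δ C ℓ²C≡ = begin
  ℓ ^ 2 * (ℓ * (ℓ * C) + ℓ₁ * ℓ * (ℓ + 1) * (P * Q) ^ 3)
    ≡⟨ distribute ℓ₁ P Q C ⟩
  ℓ ^ 2 * (ℓ ^ 2 * C) + ℓ ^ 2 * (ℓ₁ * ℓ * (ℓ + 1) * (P * Q) ^ 3)
    ≡⟨ cong (λ y → ℓ ^ 2 * y + ℓ ^ 2 * (ℓ₁ * ℓ * (ℓ + 1) * (P * Q) ^ 3)) ℓ²C≡ ⟩
  ℓ ^ 2 * (P ^ 2 * (Q ^ 3 * (ℓ + 1) * D + δ)) + ℓ ^ 2 * (ℓ₁ * ℓ * (ℓ + 1) * (P * Q) ^ 3)
    ≡⟨ collect ℓ₁ P Q D δ ⟩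
  (ℓ * P) ^ 2 * (Q ^ 3 * (ℓ + 1) * (D + ℓ₁ * (P * ℓ)) + δ) ∎
  where
  open ≡-Reasoning
  ℓ = suc ℓ₁
  distribute : ∀ x P Q C → let ℓ = 1 + x in
    ℓ * (ℓ * 1) * (ℓ * (ℓ * C) + x * ℓ * (ℓ + 1) * ((P * Q) * ((P * Q) * ((P * Q) * 1))))
    ≡ ℓ * (ℓ * 1) * (ℓ * (ℓ * 1) * C) + ℓ * (ℓ * 1) * (x * ℓ * (ℓ + 1) * ((P * Q) * ((P * Q) * ((P * Q) * 1))))
  distribute = solve-∀
  collect : ∀ x P Q D δ → let ℓ = 1 + x in
    ℓ * (ℓ * 1) * (P * (P * 1) * (Q * (Q * (Q * 1)) * (ℓ + 1) * D + δ))
      + ℓ * (ℓ * 1) * (x * ℓ * (ℓ + 1) * ((P * Q) * ((P * Q) * ((P * Q) * 1))))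
    ≡ (ℓ * P) * ((ℓ * P) * 1) * (Q * (Q * (Q * 1)) * (ℓ + 1) * (D + x * (P * ℓ)) + δ)
  collect = solve-∀

module PrimePowers (ℓ₁ : ℕ) (ℓ-prime : Prime (suc ℓ₁)) where

  open ≡-Reasoning

  ℓ : ℕ
  ℓ = suc ℓ₁

  count-step : ∀ k M → count (ℓ ^ suc k) M ≡
    ∑[ j < ℓ ^ k ] ∑[ j′ < ℓ ^ k ] completions (ℓ ^ suc k) M (j * ℓ) (j′ * ℓ) + ℓ₁ * ℓ * (ℓ + 1) * (ℓ ^ k) ^ 3
  count-step k M = begin
    count N M
      ≡⟨ ∑-split-multiples ℓ₁ Nₖ _ (N * N) (λ a ℓ∤a →
           trans (∑-cong N (λ b → completions-coprimeˡ M b (coprime ℓ∤a))) (∑-const N N)) ⟩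
    ∑[ j < Nₖ ] ∑[ b < N ] completions N M (j * ℓ) b + Nₖ * (ℓ₁ * (N * N))
      ≡⟨ cong (_+ Nₖ * (ℓ₁ * (N * N))) (∑-cong Nₖ (λ j → ∑-split-multiples ℓ₁ Nₖ _ N (λ b ℓ∤b →
           completions-coprimeʳ M (j * ℓ) (coprime ℓ∤b)))) ⟩
    ∑[ j < Nₖ ] (∑[ j′ < Nₖ ] completions N M (j * ℓ) (j′ * ℓ) + Nₖ * (ℓ₁ * N)) + Nₖ * (ℓ₁ * (N * N))
      ≡⟨ cong (_+ Nₖ * (ℓ₁ * (N * N))) (trans (∑-distrib-+ Nₖ _ _) (cong (S +_) (∑-const Nₖ _))) ⟩
    S + Nₖ * (Nₖ * (ℓ₁ * N)) + Nₖ * (ℓ₁ * (N * N))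
      ≡⟨ +-assoc S _ _ ⟩
    S + (Nₖ * (Nₖ * (ℓ₁ * N)) + Nₖ * (ℓ₁ * (N * N)))
      ≡⟨ cong (S +_) (collect ℓ₁ Nₖ) ⟩
    S + ℓ₁ * ℓ * (ℓ + 1) * Nₖ ^ 3 ∎
    where
    Nₖ = ℓ ^ k
    N = ℓ ^ suc k
    S = ∑[ j < Nₖ ] ∑[ j′ < Nₖ ] completions N M (j * ℓ) (j′ * ℓ)
    instance
      _ : NonZero N
      _ = m^n≢0 ℓ (suc k)
    coprime : ∀ {a} → ¬ ℓ ∣ a → Coprime a N
    coprime ℓ∤a = prime∤⇒coprime-^ ℓ-prime ℓ∤a (suc k)
    collect : ∀ x n → n * (n * (x * ((1 + x) * n))) + n * (x * ((1 + x) * n * ((1 + x) * n)))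
                      ≡ x * (1 + x) * ((1 + x) + 1) * (n * (n * (n * 1)))
    collect = solve-∀

  count-nonmultiple : ∀ k {M} → ¬ ℓ ∣ M → count (ℓ ^ suc k) M ≡ ℓ₁ * ℓ * (ℓ + 1) * (ℓ ^ k) ^ 3
  count-nonmultiple k {M} ℓ∤M = begin
    count (ℓ ^ suc k) M
      ≡⟨ count-step k M ⟩
    ∑[ j < ℓ ^ k ] ∑[ j′ < ℓ ^ k ] completions (ℓ ^ suc k) M (j * ℓ) (j′ * ℓ) + ℓ₁ * ℓ * (ℓ + 1) * (ℓ ^ k) ^ 3
      ≡⟨ cong (_+ ℓ₁ * ℓ * (ℓ + 1) * (ℓ ^ k) ^ 3) (trans (∑-cong (ℓ ^ k) (λ j → trans
           (∑-cong (ℓ ^ k) (λ j′ → completions-vanish j j′ (m∣m*n (ℓ ^ k)) ℓ∤M)) (∑-zero (ℓ ^ k))))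
           (∑-zero (ℓ ^ k))) ⟩
    ℓ₁ * ℓ * (ℓ + 1) * (ℓ ^ k) ^ 3 ∎

  count-multiple : ∀ k M → count (ℓ ^ suc k) (M * ℓ) ≡ ℓ * (ℓ * count (ℓ ^ k) M) + ℓ₁ * ℓ * (ℓ + 1) * (ℓ ^ k) ^ 3
  count-multiple k M = begin
    count (ℓ ^ suc k) (M * ℓ)
      ≡⟨ count-step k (M * ℓ) ⟩
    ∑[ j < Nₖ ] ∑[ j′ < Nₖ ] completions (ℓ * Nₖ) (M * ℓ) (j * ℓ) (j′ * ℓ) + ℓ₁ * ℓ * (ℓ + 1) * Nₖ ^ 3
      ≡⟨ cong (_+ ℓ₁ * ℓ * (ℓ + 1) * Nₖ ^ 3) (trans
           (∑-cong Nₖ (λ j → trans (∑-cong Nₖ (λ j′ → completions-scale ℓ Nₖ M j j′))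
             (trans (∑-distribˡ-* Nₖ ℓ _) (cong (ℓ *_) (∑-distribˡ-* Nₖ ℓ _)))))
           (trans (∑-distribˡ-* Nₖ ℓ _) (cong (ℓ *_) (∑-distribˡ-* Nₖ ℓ _)))) ⟩
    ℓ * (ℓ * count Nₖ M) + ℓ₁ * ℓ * (ℓ + 1) * Nₖ ^ 3 ∎
    where
    Nₖ = ℓ ^ k

  closed-form : ∀ r s M → ℓ ^ r ∣ M → ¬ ℓ ^ (r + 1) ∣ M →
    ℓ ^ 2 * count (ℓ ^ (r + s)) M ≡ ℓ ^ (2 * r) * (ℓ ^ (3 * s) * (ℓ + 1) * (ℓ ^ (r + 1) ∸ 1) + δ s)
  closed-form zero zero M _ _ = trans (cong (ℓ ^ 2 *_) (count-one M)) (square ℓ₁)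
    where
    square : ∀ x → (1 + x) * ((1 + x) * 1) * 1 ≡ 1 * (1 * ((1 + x) + 1) * (x * 1) + 1)
    square = solve-∀
  closed-form zero (suc k) M _ ℓ∤M = begin
    ℓ ^ 2 * count (ℓ ^ suc k) M
      ≡⟨ cong (ℓ ^ 2 *_) (count-nonmultiple k (ℓ∤M ∘ subst (_∣ M) (sym (*-identityʳ ℓ)))) ⟩
    ℓ ^ 2 * (ℓ₁ * ℓ * (ℓ + 1) * (ℓ ^ k) ^ 3)
      ≡⟨ rearrange ℓ₁ (ℓ ^ k) ⟩
    1 * ((ℓ ^ suc k) ^ 3 * (ℓ + 1) * (ℓ₁ * 1) + 0)
      ≡⟨ cong (λ x → 1 * (x * (ℓ + 1) * (ℓ₁ * 1) + 0)) (^-*3 ℓ (suc k)) ⟨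
    ℓ ^ (2 * 0) * (ℓ ^ (3 * suc k) * (ℓ + 1) * (ℓ ^ (0 + 1) ∸ 1) + δ (suc k)) ∎
    where
    rearrange : ∀ x n → let ℓ = 1 + x in
      ℓ * (ℓ * 1) * (x * ℓ * (ℓ + 1) * (n * (n * (n * 1))))
      ≡ 1 * ((ℓ * n) * ((ℓ * n) * ((ℓ * n) * 1)) * (ℓ + 1) * (x * 1) + 0)
    rearrange = solve-∀
  closed-form (suc r) s M ℓʳ⁺¹∣M ℓʳ⁺²∤M with m*n∣⇒m∣ ℓ (ℓ ^ r) ℓʳ⁺¹∣M
  ... | divides q refl = begin
    ℓ ^ 2 * count (ℓ ^ suc (r + s)) (q * ℓ)
      ≡⟨ cong (ℓ ^ 2 *_) (count-multiple (r + s) q) ⟩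
    ℓ ^ 2 * (ℓ * (ℓ * C) + ℓ₁ * ℓ * (ℓ + 1) * (ℓ ^ (r + s)) ^ 3)
      ≡⟨ cong (λ x → ℓ ^ 2 * (ℓ * (ℓ * C) + ℓ₁ * ℓ * (ℓ + 1) * x ^ 3)) (^-distribˡ-+-* ℓ r s) ⟩
    ℓ ^ 2 * (ℓ * (ℓ * C) + ℓ₁ * ℓ * (ℓ + 1) * (P * Q) ^ 3)
      ≡⟨ closed-form-step ℓ₁ P Q D (δ s) C IH ⟩
    (ℓ * P) ^ 2 * (Q ^ 3 * (ℓ + 1) * (D + ℓ₁ * (P * ℓ)) + δ s)
      ≡⟨ cong₂ (λ x y → x * (y * (ℓ + 1) * (D + ℓ₁ * (P * ℓ)) + δ s)) (^-*2 ℓ (suc r)) (^-*3 ℓ s) ⟨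
    ℓ ^ (2 * suc r) * (ℓ ^ (3 * s) * (ℓ + 1) * (D + ℓ₁ * (P * ℓ)) + δ s)
      ≡⟨ cong (λ x → ℓ ^ (2 * suc r) * (ℓ ^ (3 * s) * (ℓ + 1) * x + δ s)) ℓʳ⁺²∸1 ⟨
    ℓ ^ (2 * suc r) * (ℓ ^ (3 * s) * (ℓ + 1) * (ℓ ^ (suc r + 1) ∸ 1) + δ s) ∎
    where
    P = ℓ ^ r
    Q = ℓ ^ s
    D = ℓ ^ (r + 1) ∸ 1
    C = count (ℓ ^ (r + s)) q
    instance
      _ : NonZero (ℓ ^ (r + 1))
      _ = m^n≢0 ℓ (r + 1)
    ℓʳ⁺²∸1 : ℓ ^ (suc r + 1) ∸ 1 ≡ D + ℓ₁ * (P * ℓ)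
    ℓʳ⁺²∸1 = trans (suc*∸1 ℓ₁ (ℓ ^ (r + 1))) (cong (λ x → D + ℓ₁ * x) (^-+1 ℓ r))
    ℓʳ∣q : ℓ ^ r ∣ q
    ℓʳ∣q = *-cancelˡ-∣ ℓ (subst (ℓ * ℓ ^ r ∣_) (*-comm q ℓ) ℓʳ⁺¹∣M)
    ℓʳ⁺¹∤q : ¬ ℓ ^ (r + 1) ∣ q
    ℓʳ⁺¹∤q = ℓʳ⁺²∤M ∘ subst (ℓ * ℓ ^ (r + 1) ∣_) (*-comm ℓ q) ∘ *-monoʳ-∣ ℓ
    IH : ℓ ^ 2 * C ≡ P ^ 2 * (Q ^ 3 * (ℓ + 1) * D + δ s)
    IH = trans (closed-form r s q ℓʳ∣q ℓʳ⁺¹∤q) (cong₂ (λ x y → x * (y * (ℓ + 1) * D + δ s)) (^-*2 ℓ r) (^-*3 ℓ s))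

propositionA5 : (ℓ M r s : ℕ) → Prime ℓ → 0 < M →
    (ℓ ^ r) ∣ M → ¬ ((ℓ ^ (r + 1)) ∣ M) →
    (ℓ ^ 2) * countDet (ℓ ^ (r + s)) M
      ≡ (ℓ ^ (2 * r)) * ((ℓ ^ (3 * s)) * (ℓ + 1) * ((ℓ ^ (r + 1)) ∸ 1) + δ s)
propositionA5 zero     M r s ℓ-prime _ _ _ = ⊥-elim (¬prime[0] ℓ-prime)
propositionA5 (suc ℓ₁) M r s ℓ-prime _ ℓʳ∣M ℓʳ⁺¹∤M =
  trans (cong (suc ℓ₁ ^ 2 *_) (countDet≡count (suc ℓ₁ ^ (r + s)) M))
        (PrimePowers.closed-form ℓ₁ ℓ-prime r s M ℓʳ∣M ℓʳ⁺¹∤M)
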